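{- For every field $K$ and every $\varepsilon\in(0,1/2)$, and every $n\ge1$, there is a multilinear polynomial $p(x_1,\dots,x_n,y_1,\dots,y_n)$ over $K$ with at most $2^{\,n-\Omega(\varepsilon^2 n)}$ monomials such that for all $\vec x,\vec y\in\{0,1\}^n$ with $\langle\vec x,\vec y\rangle\in[2\varepsilon n,(1/2+\varepsilon)n]$ we have $p(\vec x,\vec y)=(-1)^{\langle\vec x,\vec y\rangle}$. (The constant implied by $\Omega(\cdot)$ is absolute.)
   Context: $\langle\vec x,\vec y\rangle=\sum_{k=1}^n x_ky_k$ denotes the integer inner product of $0/1$ vectors.
   Formalization: The parameter ε ranges only over the rationals in (0,1/2). -}

module Defs where

open import Level using (Level; _⊔_; suc; Setω)
open import Algebra.Bundles using (CommutativeRing)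
open import Data.Bool using (Bool; true; false; _∧_)
open import Data.Nat as ℕ using (ℕ; zero) renaming (suc to 1+)
open import Data.Integer as ℤ using (ℤ; +_; -[1+_])
open import Data.Rational using (ℚ; ↥_; ↧ₙ_)
open import Data.List using (List; []; _∷_; length)
open import Data.Product using (_×_; _,_; Σ)
open import Data.Vec using (Vec; []; _∷_)
open import Data.Fin.Subset using (Subset)
open import Relation.Nullary using (¬_)

record Field (c ℓ : Level) : Set (suc (c ⊔ ℓ)) where
  field
    commutativeRing : CommutativeRing c ℓ
  open CommutativeRing commutativeRing public
  field
    0≉1     : ¬ (0# ≈ 1#)
    inverse : ∀ x → ¬ (x ≈ 0#) → Σ Carrier λ y → x * y ≈ 1#

⟨_,_⟩ : ∀ {n} → Vec Bool n → Vec Bool n → ℕ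
⟨ [] , [] ⟩ = 0
⟨ a ∷ x , b ∷ y ⟩ = (if a ∧ b then 1 else 0) ℕ.+ ⟨ x , y ⟩
  where open import Data.Bool using (if_then_else_)

module _ {c ℓ} (K : Field c ℓ) where
  open Field K

  bit : Bool → Carrier
  bit true  = 1#
  bit false = 0#

  monoVal : ∀ {n} → Subset n → Vec Carrier n → Carrier
  monoVal []          []      = 1#
  monoVal (true ∷ S)  (z ∷ zs) = z * monoVal S zs
  monoVal (false ∷ S) (z ∷ zs) = monoVal S zs

  -- A multilinear polynomial in x_1..x_n, y_1..y_n, given as a list of
  -- terms (coefficient, S, T) standing for coeff · ∏_{i∈S} x_i · ∏_{j∈T} y_j.
  -- A polynomial has at most M monomials iff it can be written with a
  -- list of at most M terms.
  MPoly : ℕ → Set c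
  MPoly n = List (Carrier × Subset n × Subset n)

  eval : ∀ {n} → MPoly n → Vec Carrier n → Vec Carrier n → Carrier
  eval []                  x y = 0#
  eval ((k , S , T) ∷ ts)  x y = k * monoVal S x * monoVal T y + eval ts x y

  signPow : ℕ → Carrier
  signPow zero   = 1#
  signPow (1+ m) = - signPow m

-- M ≤ 2^q for a rational exponent q = a/d (d ≥ 1), i.e.
--   a = +m      :  M^d ≤ 2^m
--   a = -(m+1)  :  M^d · 2^(m+1) ≤ 1
_≤2^_ : ℕ → ℚ → Set
M ≤2^ q with ↥ q
... | + m      = M ℕ.^ (↧ₙ q) ℕ.≤ 2 ℕ.^ m
... | -[1+ m ] = M ℕ.^ (↧ₙ q) ℕ.* 2 ℕ.^ (1+ m) ℕ.≤ 1

-- Σ-type whose second component lives in Setω (needed because the absolute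
-- constant is chosen before quantifying over fields of all universe levels).
record Σω (A : Set) (P : A → Set) (B : A → Setω) : Setω where
  constructor _,ω_,ω_
  field
    fst  : A
    prop : P fst
    snd  : B fst

-- The integers k with 2εn ≤ k ≤ (1/2 + ε)n form a window [L, L + w] with
-- w ≤ (1/2 − ε)n. Newton interpolation gives b₀, …, b_w with Σⱼ bⱼ·C(k, j) = (−1)^k on the
-- window, and p(x, y) = Σ_{|S| ≤ w} b_{|S|} ∏_{i∈S} xᵢyᵢ takes the value Σⱼ bⱼ·C(⟨x,y⟩, j)
-- at 0/1 points, with Σ_{j≤w} C(n, j) monomials. Below (1/2 − ε/2)n consecutive binomial
-- coefficients grow by a factor at least 1 + ε, so shifting this partial sum by s ≈ εn/2
-- places gains a factor (1 + ε)^s while the shifted sum stays below 2^(n−1). By Bernoulli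
-- (1 + ε)^t ≥ 2 for t = ⌊1/ε⌋ + 1, so the count is at most 2^(n − 1 − s/t) ≤ 2^(n − ε²n/8).

module Submission where

open import Defs

module BinomialSums where

  open import Data.List using (applyUpTo)
  open import Data.Nat
  open import Data.Nat.Combinatorics using (_C_; nCk+nC[k+1]≡[n+1]C[k+1]; nC1≡n)
  open import Data.Nat.ListAction using (sum)
  open import Data.Nat.Properties
  open import Algebra.Properties.CommutativeSemigroup +-commutativeSemigroup
    using (interchange)
  open import Data.Nat.Tactic.RingSolver using (solve-∀)
  open import Function using (_∘_)
  open import Relation.Binary.PropositionalEquality

  sum-applyUpTo-cong : ∀ {f g : ℕ → ℕ} l → (∀ j → f j ≡ g j) →
                       sum (applyUpTo f l) ≡ sum (applyUpTo g l)
  sum-applyUpTo-cong zero    f≗g = refl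
  sum-applyUpTo-cong (suc l) f≗g = cong₂ _+_ (f≗g 0) (sum-applyUpTo-cong l (f≗g ∘ suc))

  sum-applyUpTo-+ : ∀ f g l → sum (applyUpTo (λ j → f j + g j) l) ≡
                              sum (applyUpTo f l) + sum (applyUpTo g l)
  sum-applyUpTo-+ f g zero    = refl
  sum-applyUpTo-+ f g (suc l) = begin
    f 0 + g 0 + sum (applyUpTo (λ j → f (suc j) + g (suc j)) l)
      ≡⟨ cong (f 0 + g 0 +_) (sum-applyUpTo-+ (f ∘ suc) (g ∘ suc) l) ⟩
    f 0 + g 0 + (sum (applyUpTo (f ∘ suc) l) + sum (applyUpTo (g ∘ suc) l))
      ≡⟨ interchange (f 0) (g 0) _ _ ⟩
    sum (applyUpTo f (suc l)) + sum (applyUpTo g (suc l)) ∎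
    where open ≡-Reasoning

  sum-applyUpTo-const-0 : ∀ l → sum (applyUpTo (λ _ → 0) l) ≡ 0
  sum-applyUpTo-const-0 zero    = refl
  sum-applyUpTo-const-0 (suc l) = sum-applyUpTo-const-0 l

  sum-applyUpTo-shift-≤ : ∀ f l {x y} → (∀ j → j < l → f j * x ≤ f (suc j) * y) →
                          sum (applyUpTo f l) * x ≤ sum (applyUpTo (f ∘ suc) l) * y
  sum-applyUpTo-shift-≤ f zero    _ = z≤n
  sum-applyUpTo-shift-≤ f (suc l) {x} {y} ratio = begin
    (f 0 + sum (applyUpTo (f ∘ suc) l)) * x
      ≡⟨ *-distribʳ-+ x (f 0) _ ⟩
    f 0 * x + sum (applyUpTo (f ∘ suc) l) * x
      ≤⟨ +-mono-≤ (ratio 0 z<s) (sum-applyUpTo-shift-≤ (f ∘ suc) l (λ j j<l → ratio (suc j) (s<s j<l))) ⟩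
    f 1 * y + sum (applyUpTo (f ∘ suc ∘ suc) l) * y
      ≡⟨ *-distribʳ-+ y (f 1) _ ⟨
    (f 1 + sum (applyUpTo (f ∘ suc ∘ suc) l)) * y ∎
    where open ≤-Reasoning

  binomialSum : ℕ → ℕ → ℕ
  binomialSum n l = sum (applyUpTo (n C_) l)

  binomialSum-suc : ∀ n l → binomialSum (suc n) l ≡ binomialSum n l + binomialSum n (l ∸ 1)
  binomialSum-suc n zero    = refl
  binomialSum-suc n (suc l) = begin
    1 + sum (applyUpTo (λ j → suc n C suc j) l)
      ≡⟨ cong (1 +_) (sum-applyUpTo-cong l (λ j → sym (nCk+nC[k+1]≡[n+1]C[k+1] n j))) ⟩
    1 + sum (applyUpTo (λ j → n C j + n C suc j) l)
      ≡⟨ cong (1 +_) (sum-applyUpTo-+ (n C_) (λ j → n C suc j) l) ⟩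
    1 + (binomialSum n l + sum (applyUpTo (λ j → n C suc j) l))
      ≡⟨ cong suc (+-comm (binomialSum n l) _) ⟩
    binomialSum n (suc l) + binomialSum n l ∎
    where open ≡-Reasoning

  binomialSum≤2^ : ∀ n l → binomialSum n l ≤ 2 ^ n
  binomialSum≤2^ zero    zero    = z≤n
  binomialSum≤2^ zero    (suc l) = ≤-reflexive (cong suc (sum-applyUpTo-const-0 l))
  binomialSum≤2^ (suc n) l = begin
    binomialSum (suc n) l                    ≡⟨ binomialSum-suc n l ⟩
    binomialSum n l + binomialSum n (l ∸ 1)  ≤⟨ +-mono-≤ (binomialSum≤2^ n l) (binomialSum≤2^ n (l ∸ 1)) ⟩
    2 ^ n + 2 ^ n                            ≡⟨ cong (2 ^ n +_) (+-identityʳ (2 ^ n)) ⟨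
    2 ^ suc n                                ∎
    where open ≤-Reasoning

  binomialSum-pair : ∀ n l l′ → l + l′ ≤ suc n → binomialSum n l + binomialSum n l′ ≤ 2 ^ n
  binomialSum-pair n       zero    l′      _ = binomialSum≤2^ n l′
  binomialSum-pair n       (suc a) zero    _ =
    subst (_≤ 2 ^ n) (sym (+-identityʳ _)) (binomialSum≤2^ n (suc a))
  binomialSum-pair zero    (suc a) (suc b) (s≤s h) with () ← subst (_≤ 0) (+-suc a b) h
  binomialSum-pair (suc n) (suc a) (suc b) (s≤s h) = begin
    binomialSum (suc n) (suc a) + binomialSum (suc n) (suc b)
      ≡⟨ cong₂ _+_ (binomialSum-suc n (suc a)) (binomialSum-suc n (suc b)) ⟩
    (B (suc a) + B a) + (B (suc b) + B b)
      ≡⟨ rearrange (B (suc a)) (B a) (B (suc b)) (B b) ⟩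
    (B (suc a) + B b) + (B a + B (suc b))
      ≤⟨ +-mono-≤ (binomialSum-pair n (suc a) b (subst (_≤ suc n) (+-suc a b) h))
                  (binomialSum-pair n a (suc b) h) ⟩
    2 ^ n + 2 ^ n
      ≡⟨ cong (2 ^ n +_) (+-identityʳ (2 ^ n)) ⟨
    2 ^ suc n ∎
    where
    open ≤-Reasoning
    B = binomialSum n
    rearrange : ∀ w x y z → (w + x) + (y + z) ≡ (w + z) + (x + y)
    rearrange = solve-∀

  C-absorption : ∀ n j → suc j * (n C suc j) + j * (n C j) ≡ n * (n C j)
  C-absorption zero    zero    = refl
  C-absorption zero    (suc j) = cong₂ _+_ (*-zeroʳ (suc (suc j))) (*-zeroʳ (suc j))
  C-absorption (suc n) zero    = begin
    1 * (suc n C 1) + 0  ≡⟨ trans (+-identityʳ _) (*-identityˡ _) ⟩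
    suc n C 1            ≡⟨ nC1≡n (suc n) ⟩
    suc n                ≡⟨ *-identityʳ (suc n) ⟨
    suc n * 1            ∎
    where open ≡-Reasoning
  C-absorption (suc n) (suc i) = begin
    suc (suc i) * (suc n C suc (suc i)) + suc i * (suc n C suc i)
      ≡⟨ cong₂ (λ u v → suc (suc i) * u + suc i * v)
               (nCk+nC[k+1]≡[n+1]C[k+1] n (suc i)) (nCk+nC[k+1]≡[n+1]C[k+1] n i) ⟨
    suc (suc i) * (b + c) + suc i * (a + b)
      ≡⟨ regroup i a b c ⟩
    (suc i * b + i * a) + (suc (suc i) * c + suc i * b) + (a + b)
      ≡⟨ cong₂ (λ u v → u + v + (a + b)) (C-absorption n i) (C-absorption n (suc i)) ⟩
    n * a + n * b + (a + b)
      ≡⟨ collect n a b ⟩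
    suc n * (a + b)
      ≡⟨ cong (suc n *_) (nCk+nC[k+1]≡[n+1]C[k+1] n i) ⟩
    suc n * (suc n C suc i) ∎
    where
    open ≡-Reasoning
    a = n C i
    b = n C suc i
    c = n C suc (suc i)
    regroup : ∀ i a b c → suc (suc i) * (b + c) + suc i * (a + b) ≡
                          (suc i * b + i * a) + (suc (suc i) * c + suc i * b) + (a + b)
    regroup = solve-∀
    collect : ∀ n a b → n * a + n * b + (a + b) ≡ suc n * (a + b)
    collect = solve-∀

  C-ratio : ∀ n j {x y} → suc j * x + j * y ≤ n * y → (n C j) * x ≤ (n C suc j) * y
  C-ratio n j {x} {y} h = *-cancelˡ-≤ (suc j) (+-cancelʳ-≤ (j * c * y) _ _ (begin
    suc j * (c * x) + j * c * y    ≡⟨ lhs j c x y ⟩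
    c * (suc j * x + j * y)        ≤⟨ *-monoʳ-≤ c h ⟩
    c * (n * y)                    ≡⟨ *-assoc c n y ⟨
    c * n * y                      ≡⟨ cong (_* y) (trans (*-comm c n) (sym (C-absorption n j))) ⟩
    (suc j * c′ + j * c) * y       ≡⟨ rhs j c c′ y ⟩
    suc j * (c′ * y) + j * c * y   ∎))
    where
    open ≤-Reasoning
    c = n C j
    c′ = n C suc j
    lhs : ∀ j c x y → suc j * (c * x) + j * c * y ≡ c * (suc j * x + j * y)
    lhs = solve-∀
    rhs : ∀ j c c′ y → (suc j * c′ + j * c) * y ≡ suc j * (c′ * y) + j * c * y
    rhs = solve-∀

  binomialSum-shift-step : ∀ n l {x y} → (∀ j → j < l → (n C j) * x ≤ (n C suc j) * y) →
                       binomialSum n l * x ≤ binomialSum n (suc l) * y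
  binomialSum-shift-step n l {y = y} ratio = ≤-trans (sum-applyUpTo-shift-≤ (n C_) l ratio)
    (*-monoˡ-≤ y (m≤n+m (sum (applyUpTo (λ j → n C suc j) l)) (n C 0)))

  binomialSum-shift : ∀ n l s {x y} → (∀ j → j < l + s → (n C j) * x ≤ (n C suc j) * y) →
                      binomialSum n (suc l) * x ^ s ≤ binomialSum n (suc l + s) * y ^ s
  binomialSum-shift n l zero    _ =
    ≤-reflexive (cong (λ m → binomialSum n m * 1) (sym (+-identityʳ (suc l))))
  binomialSum-shift n l (suc s) {x} {y} ratio = begin
    binomialSum n (suc l) * (x * x ^ s)      ≡⟨ swap (binomialSum n (suc l)) x (x ^ s) ⟩
    binomialSum n (suc l) * x ^ s * x        ≤⟨ *-monoˡ-≤ x (binomialSum-shift n l s (λ j → ratio′ j ∘ m<n⇒m<1+n)) ⟩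
    binomialSum n L * y ^ s * x              ≡⟨ swap (binomialSum n L) x (y ^ s) ⟨
    binomialSum n L * (x * y ^ s)            ≡⟨ *-assoc (binomialSum n L) x (y ^ s) ⟨
    binomialSum n L * x * y ^ s              ≤⟨ *-monoˡ-≤ (y ^ s) (binomialSum-shift-step n L ratio′) ⟩
    binomialSum n (suc L) * y * y ^ s        ≡⟨ cong (λ m → binomialSum n m * y * y ^ s) (+-suc (suc l) s) ⟨
    binomialSum n (suc l + suc s) * y * y ^ s   ≡⟨ *-assoc (binomialSum n (suc l + suc s)) y (y ^ s) ⟩
    binomialSum n (suc l + suc s) * (y * y ^ s) ∎
    where
    open ≤-Reasoning
    L = suc l + s
    ratio′ : ∀ j → j < suc (l + s) → (n C j) * x ≤ (n C suc j) * y
    ratio′ j j< = ratio j (subst (j <_) (sym (+-suc l s)) j<)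
    swap : ∀ a b c → a * (b * c) ≡ a * c * b
    swap = solve-∀

  -- Below W + s consecutive binomial coefficients grow by a factor at least (r + p)/r,
  -- and the shifted sum binomialSum n (suc W + s) is at most 2^(n−1).
  binomialSum-tail : ∀ n W s {r p} → 1 ≤ p * n → 2 * r * (W + s) + p * n ≤ r * n →
                     binomialSum n (suc W) * (r + p) ^ s * 2 ≤ r ^ s * 2 ^ n
  binomialSum-tail n W s {r} {p} pn≥1 budget = begin
    binomialSum n (suc W) * (r + p) ^ s * 2    ≤⟨ *-monoˡ-≤ 2 (binomialSum-shift n W s ratio) ⟩
    binomialSum n (suc m) * r ^ s * 2          ≡⟨ swap (binomialSum n (suc m)) (r ^ s) 2 ⟩
    r ^ s * (binomialSum n (suc m) * 2)        ≤⟨ *-monoʳ-≤ (r ^ s) half ⟩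
    r ^ s * 2 ^ n                              ∎
    where
    open ≤-Reasoning
    m = W + s
    m+m<n : m + m < n
    m+m<n = *-cancelˡ-< r (m + m) n (begin-strict
      r * (m + m)           ≡⟨ double r m ⟩
      2 * r * m             <⟨ m<m+n (2 * r * m) pn≥1 ⟩
      2 * r * m + p * n     ≤⟨ budget ⟩
      r * n                 ∎)
      where
      double : ∀ r m → r * (m + m) ≡ 2 * r * m
      double = solve-∀
    ratio : ∀ j → j < m → (n C j) * (r + p) ≤ (n C suc j) * r
    ratio j j<m = C-ratio n j (begin
      suc j * (r + p) + j * r     ≤⟨ +-mono-≤ (*-monoˡ-≤ (r + p) j<m) (*-monoˡ-≤ r (<⇒≤ j<m)) ⟩
      m * (r + p) + m * r         ≡⟨ expand m r p ⟩
      2 * r * m + p * m           ≤⟨ +-monoʳ-≤ (2 * r * m) (*-monoʳ-≤ p (≤-trans (m≤m+n m m) (<⇒≤ m+m<n))) ⟩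
      2 * r * m + p * n           ≤⟨ budget ⟩
      r * n                       ≡⟨ *-comm r n ⟩
      n * r                       ∎)
      where
      expand : ∀ m r p → m * (r + p) + m * r ≡ 2 * r * m + p * m
      expand = solve-∀
    half : binomialSum n (suc m) * 2 ≤ 2 ^ n
    half = subst (_≤ 2 ^ n) (double (binomialSum n (suc m)))
             (binomialSum-pair n (suc m) (suc m) (s≤s (subst (_≤ n) (sym (+-suc m m)) m+m<n)))
      where
      double : ∀ x → x + x ≡ x * 2
      double = solve-∀
    swap : ∀ a b c → a * b * c ≡ b * (a * c)
    swap = solve-∀

module Powers where

  open import Data.Nat
  open import Data.Nat.Properties
  open import Data.Nat.Tactic.RingSolver using (solve-∀)
  open import Relation.Binary.PropositionalEquality
  open import Relation.Nullary using (yes; no; contradiction)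

  ^-distribʳ-* : ∀ m n k → (m * n) ^ k ≡ m ^ k * n ^ k
  ^-distribʳ-* m n zero    = refl
  ^-distribʳ-* m n (suc k) = trans (cong (m * n *_) (^-distribʳ-* m n k)) (regroup m n (m ^ k) (n ^ k))
    where
    regroup : ∀ a b x y → a * b * (x * y) ≡ a * x * (b * y)
    regroup = solve-∀

  ^-comm : ∀ m j k → (m ^ j) ^ k ≡ (m ^ k) ^ j
  ^-comm m j k = trans (^-*-assoc m j k) (trans (cong (m ^_) (*-comm j k)) (sym (^-*-assoc m k j)))

  ^-cancelʳ-≤ : ∀ k .{{_ : NonZero k}} {m n} → m ^ k ≤ n ^ k → m ≤ n
  ^-cancelʳ-≤ k {m} {n} mᵏ≤nᵏ with m ≤? n
  ... | yes m≤n = m≤n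
  ... | no  m≰n = contradiction (^-monoˡ-< k (≰⇒> m≰n)) (≤⇒≯ mᵏ≤nᵏ)

  bernoulli : ∀ r p t → r ^ t * (r + t * p) ≤ r * (r + p) ^ t
  bernoulli r p zero    = ≤-reflexive (base r p)
    where
    base : ∀ r p → 1 * (r + 0 * p) ≡ r * 1
    base = solve-∀
  bernoulli r p (suc t) = begin
    r * r ^ t * (r + suc t * p)                          ≤⟨ m≤m+n _ (r ^ t * t * p * p) ⟩
    r * r ^ t * (r + suc t * p) + r ^ t * t * p * p      ≡⟨ factor r (r ^ t) t p ⟩
    r ^ t * (r + t * p) * (r + p)                        ≤⟨ *-monoˡ-≤ (r + p) (bernoulli r p t) ⟩
    r * (r + p) ^ t * (r + p)                            ≡⟨ reorder r ((r + p) ^ t) (r + p) ⟩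
    r * ((r + p) * (r + p) ^ t)                          ∎
    where
    open ≤-Reasoning
    factor : ∀ r x t p → r * x * (r + suc t * p) + x * t * p * p ≡ x * (r + t * p) * (r + p)
    factor = solve-∀
    reorder : ∀ a b c → a * b * c ≡ a * (c * b)
    reorder = solve-∀

  doubling : ∀ r p t .{{_ : NonZero r}} → r ≤ t * p → 2 * r ^ t ≤ (r + p) ^ t
  doubling r p t r≤tp = *-cancelˡ-≤ r (begin
    r * (2 * r ^ t)          ≡⟨ reorder r (r ^ t) ⟩
    r ^ t * (r + r)          ≤⟨ *-monoʳ-≤ (r ^ t) (+-monoʳ-≤ r r≤tp) ⟩
    r ^ t * (r + t * p)      ≤⟨ bernoulli r p t ⟩
    r * (r + p) ^ t          ∎)
    where
    open ≤-Reasoning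
    reorder : ∀ r x → r * (2 * x) ≡ x * (r + r)
    reorder = solve-∀

  -- In real exponents: M ≤ 2^((a − b)/t) and (a − b)/t ≤ (a′ − c)/d give M ≤ 2^((a′ − c)/d).
  2^-bound-rescale : ∀ {M t b a d c a′} .{{_ : NonZero t}} →
                     M ^ t * 2 ^ b ≤ 2 ^ a → a * d + c * t ≤ a′ * t + b * d →
                     M ^ d * 2 ^ c ≤ 2 ^ a′
  2^-bound-rescale {M} {t} {b} {a} {d} {c} {a′} bound exponents =
    ^-cancelʳ-≤ t (*-cancelʳ-≤ _ _ (2 ^ (b * d)) {{m^n≢0 2 (b * d)}} (begin
      (M ^ d * 2 ^ c) ^ t * 2 ^ (b * d)     ≡⟨ cong (_* 2 ^ (b * d)) (^-distribʳ-* (M ^ d) (2 ^ c) t) ⟩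
      (M ^ d) ^ t * (2 ^ c) ^ t * 2 ^ (b * d)
        ≡⟨ cong₂ (λ u v → u * v * 2 ^ (b * d)) (^-comm M d t) (^-*-assoc 2 c t) ⟩
      (M ^ t) ^ d * 2 ^ (c * t) * 2 ^ (b * d)
        ≡⟨ swap ((M ^ t) ^ d) (2 ^ (c * t)) (2 ^ (b * d)) ⟩
      (M ^ t) ^ d * 2 ^ (b * d) * 2 ^ (c * t)
        ≡⟨ cong (λ u → (M ^ t) ^ d * u * 2 ^ (c * t)) (^-*-assoc 2 b d) ⟨
      (M ^ t) ^ d * (2 ^ b) ^ d * 2 ^ (c * t)
        ≡⟨ cong (_* 2 ^ (c * t)) (^-distribʳ-* (M ^ t) (2 ^ b) d) ⟨
      (M ^ t * 2 ^ b) ^ d * 2 ^ (c * t)     ≤⟨ *-monoˡ-≤ (2 ^ (c * t)) (^-monoˡ-≤ d bound) ⟩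
      (2 ^ a) ^ d * 2 ^ (c * t)             ≡⟨ cong (_* 2 ^ (c * t)) (^-*-assoc 2 a d) ⟩
      2 ^ (a * d) * 2 ^ (c * t)             ≡⟨ ^-distribˡ-+-* 2 (a * d) (c * t) ⟨
      2 ^ (a * d + c * t)                   ≤⟨ ^-monoʳ-≤ 2 exponents ⟩
      2 ^ (a′ * t + b * d)                  ≡⟨ ^-distribˡ-+-* 2 (a′ * t) (b * d) ⟩
      2 ^ (a′ * t) * 2 ^ (b * d)            ≡⟨ cong (_* 2 ^ (b * d)) (^-*-assoc 2 a′ t) ⟨
      (2 ^ a′) ^ t * 2 ^ (b * d)            ∎))
    where
    open ≤-Reasoning
    swap : ∀ x y z → x * y * z ≡ x * z * y
    swap = solve-∀

  -- In real exponents: M ≤ 2^(n−1)·(y/x)^s and (x/y)^t ≥ 2 give M ≤ 2^(n − 1 − s/t).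
  gain⇒2^-bound : ∀ {M x y s n} t .{{_ : NonZero y}} →
                  2 * y ^ t ≤ x ^ t → M * x ^ s * 2 ≤ y ^ s * 2 ^ n →
                  M ^ t * 2 ^ (s + t) ≤ 2 ^ (n * t)
  gain⇒2^-bound {M} {x} {y} {s} {n} t gain bound =
    *-cancelˡ-≤ ((y ^ t) ^ s) {{m^n≢0 (y ^ t) s {{m^n≢0 y t}}}} (begin
      (y ^ t) ^ s * (M ^ t * 2 ^ (s + t))
        ≡⟨ cong (λ u → (y ^ t) ^ s * (M ^ t * u)) (^-distribˡ-+-* 2 s t) ⟩
      (y ^ t) ^ s * (M ^ t * (2 ^ s * 2 ^ t))       ≡⟨ regroup ((y ^ t) ^ s) (M ^ t) (2 ^ s) (2 ^ t) ⟩
      M ^ t * (2 ^ s * (y ^ t) ^ s) * 2 ^ t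
        ≡⟨ cong (λ u → M ^ t * u * 2 ^ t) (^-distribʳ-* 2 (y ^ t) s) ⟨
      M ^ t * (2 * y ^ t) ^ s * 2 ^ t               ≤⟨ *-monoˡ-≤ (2 ^ t) (*-monoʳ-≤ (M ^ t) (^-monoˡ-≤ s gain)) ⟩
      M ^ t * (x ^ t) ^ s * 2 ^ t                   ≡⟨ cong (λ u → M ^ t * u * 2 ^ t) (^-comm x t s) ⟩
      M ^ t * (x ^ s) ^ t * 2 ^ t
        ≡⟨ cong (_* 2 ^ t) (^-distribʳ-* M (x ^ s) t) ⟨
      (M * x ^ s) ^ t * 2 ^ t                       ≡⟨ ^-distribʳ-* (M * x ^ s) 2 t ⟨
      (M * x ^ s * 2) ^ t                           ≤⟨ ^-monoˡ-≤ t bound ⟩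
      (y ^ s * 2 ^ n) ^ t                           ≡⟨ ^-distribʳ-* (y ^ s) (2 ^ n) t ⟩
      (y ^ s) ^ t * (2 ^ n) ^ t                     ≡⟨ cong₂ _*_ (^-comm y s t) (^-*-assoc 2 n t) ⟩
      (y ^ t) ^ s * 2 ^ (n * t)                     ∎)
    where
    open ≤-Reasoning
    regroup : ∀ a b c d → a * (b * (c * d)) ≡ b * (c * a) * d
    regroup = solve-∀

module BandCounting where

  open BinomialSums using (binomialSum; binomialSum-tail)
  open Powers using (doubling; gain⇒2^-bound; 2^-bound-rescale)
  open import Data.Nat
  open import Data.Nat.DivMod
  open import Data.Nat.Properties
  open import Data.Nat.Tactic.RingSolver using (solve-∀)
  open import Data.Product using (_×_; _,_)
  open import Relation.Binary.PropositionalEquality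
  open import Relation.Nullary using (yes; no)

  m<[1+m/n]*n : ∀ m n .{{_ : NonZero n}} → m < suc (m / n) * n
  m<[1+m/n]*n m n = begin-strict
    m                    ≡⟨ m≡m%n+[m/n]*n m n ⟩
    m % n + m / n * n    <⟨ +-monoˡ-< (m / n * n) (m%n<n m n) ⟩
    n + m / n * n        ∎
    where open ≤-Reasoning

  -- For ε = p/r the band 2εn ≤ k ≤ (1/2 + ε)n lies in [lower, lower + width];
  -- adding r′ = r − 1 makes lower round 2pn/r up.
  module Band (p r′ n : ℕ) where

    r : ℕ
    r = suc r′

    lower upper width shift : ℕ
    lower = (2 * p * n + r′) / r
    upper = (r + 2 * p) * n / (2 * r)
    width = upper ∸ lower
    shift = p * n / (2 * r)

    lower-spec : 2 * p * n ≤ lower * r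
    lower-spec = +-cancelʳ-≤ r′ (2 * p * n) (lower * r) (begin
      2 * p * n + r′                  ≡⟨ m≡m%n+[m/n]*n (2 * p * n + r′) r ⟩
      (2 * p * n + r′) % r + lower * r ≤⟨ +-monoˡ-≤ (lower * r) (≤-pred (m%n<n (2 * p * n + r′) r)) ⟩
      r′ + lower * r                   ≡⟨ +-comm r′ (lower * r) ⟩
      lower * r + r′                   ∎)
      where open ≤-Reasoning

    lower-min : ∀ {k} → 2 * p * n ≤ k * r → lower ≤ k
    lower-min {k} 2pn≤kr = ≤-pred (m<n*o⇒m/o<n (begin-strict
      2 * p * n + r′    ≤⟨ +-monoˡ-≤ r′ 2pn≤kr ⟩
      k * r + r′        <⟨ +-monoʳ-< (k * r) (n<1+n r′) ⟩
      k * r + r         ≡⟨ +-comm (k * r) r ⟩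
      suc k * r         ∎))
      where open ≤-Reasoning

    upper-max : ∀ {k} → k * (2 * r) ≤ (r + 2 * p) * n → k ≤ upper
    upper-max {k} h = subst (_≤ upper) (m*n/n≡m k (2 * r)) (/-monoˡ-≤ (2 * r) h)

    band⊆window : ∀ {k} → 2 * p * n ≤ k * r → k * (2 * r) ≤ (r + 2 * p) * n →
                  lower ≤ k × k ≤ lower + width
    band⊆window 2pn≤kr h = lower-min 2pn≤kr , ≤-trans (upper-max h) (m≤n+m∸n upper lower)

    width-budget : 2 * p ≤ r → 2 * r * width + 2 * p * n ≤ r * n
    width-budget 2p≤r with lower ≤? upper
    ... | no  lower≰upper = begin
      2 * r * width + 2 * p * n   ≡⟨ cong (λ w → 2 * r * w + 2 * p * n) (m≤n⇒m∸n≡0 (<⇒≤ (≰⇒> lower≰upper))) ⟩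
      2 * r * 0 + 2 * p * n       ≡⟨ cong (_+ 2 * p * n) (*-zeroʳ (2 * r)) ⟩
      2 * p * n                   ≤⟨ *-monoˡ-≤ n 2p≤r ⟩
      r * n                       ∎
      where open ≤-Reasoning
    ... | yes lower≤upper = +-cancelʳ-≤ (2 * p * n) _ _ (begin
      2 * r * width + 2 * p * n + 2 * p * n   ≡⟨ e₁ r width (2 * p * n) ⟩
      2 * r * width + 2 * (2 * p * n)         ≤⟨ +-monoʳ-≤ (2 * r * width) (*-monoʳ-≤ 2 lower-spec) ⟩
      2 * r * width + 2 * (lower * r)         ≡⟨ e₂ r width lower ⟩
      (width + lower) * (2 * r)               ≡⟨ cong (_* (2 * r)) (m∸n+n≡m lower≤upper) ⟩
      upper * (2 * r)                         ≤⟨ m/n*n≤m ((r + 2 * p) * n) (2 * r) ⟩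
      (r + 2 * p) * n                         ≡⟨ *-distribʳ-+ n r (2 * p) ⟩
      r * n + 2 * p * n                       ∎)
      where
      open ≤-Reasoning
      e₁ : ∀ r w x → 2 * r * w + x + x ≡ 2 * r * w + 2 * x
      e₁ = solve-∀
      e₂ : ∀ r w l → 2 * r * w + 2 * (l * r) ≡ (w + l) * (2 * r)
      e₂ = solve-∀

    budget : 2 * p ≤ r → 2 * r * (width + shift) + p * n ≤ r * n
    budget 2p≤r = begin
      2 * r * (width + shift) + p * n           ≡⟨ e r width shift (p * n) ⟩
      2 * r * width + shift * (2 * r) + p * n
        ≤⟨ +-monoˡ-≤ (p * n) (+-monoʳ-≤ (2 * r * width) (m/n*n≤m (p * n) (2 * r))) ⟩
      2 * r * width + p * n + p * n             ≡⟨ e′ r width p n ⟩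
      2 * r * width + 2 * p * n                 ≤⟨ width-budget 2p≤r ⟩
      r * n                                     ∎
      where
      open ≤-Reasoning
      e : ∀ r w s x → 2 * r * (w + s) + x ≡ 2 * r * w + s * (2 * r) + x
      e = solve-∀
      e′ : ∀ r w p n → 2 * r * w + p * n + p * n ≡ 2 * r * w + 2 * p * n
      e′ = solve-∀

    -- t = ⌊r/p⌋ + 1 makes (1 + p/r)^t ≥ 2, turning the factor gained in binomialSum-tail
    -- into a power of 2.
    count-bound : .{{_ : NonZero p}} → 1 ≤ n → 2 * p ≤ r →
                  binomialSum n (suc width) ^ (8 * r * r) ≤ 2 ^ (8 * r * r * n ∸ p * p * n)
    count-bound n≥1 2p≤r = *-cancelʳ-≤ _ _ (2 ^ (p * p * n)) {{m^n≢0 2 (p * p * n)}} (begin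
      M ^ D * 2 ^ (p * p * n)
        ≤⟨ 2^-bound-rescale {M} {t} {s + t} {n * t} {D} {p * p * n} {D * n} powered exponents ⟩
      2 ^ (D * n)                             ≡⟨ cong (2 ^_) (m∸n+n≡m ppn≤Dn) ⟨
      2 ^ (D * n ∸ p * p * n + p * p * n)     ≡⟨ ^-distribˡ-+-* 2 (D * n ∸ p * p * n) (p * p * n) ⟩
      2 ^ (D * n ∸ p * p * n) * 2 ^ (p * p * n) ∎)
      where
      open ≤-Reasoning
      M = binomialSum n (suc width)
      D = 8 * r * r
      s = shift
      t = suc (r / p)
      p≤r : p ≤ r
      p≤r = ≤-trans (m≤m+n p (p + 0)) 2p≤r
      powered : M ^ t * 2 ^ (s + t) ≤ 2 ^ (n * t)
      powered = gain⇒2^-bound {M} {r + p} {r} {s} {n} t (doubling r p t (<⇒≤ (m<[1+m/n]*n r p)))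
                  (binomialSum-tail n width s (*-mono-≤ (>-nonZero⁻¹ p) n≥1) (budget 2p≤r))
      tp≤2r : t * p ≤ 2 * r
      tp≤2r = begin
        p + r / p * p   ≤⟨ +-mono-≤ p≤r (m/n*n≤m r p) ⟩
        r + r           ≡⟨ cong (r +_) (+-identityʳ r) ⟨
        2 * r           ∎
      s+1≤s+t : suc s ≤ s + t
      s+1≤s+t = subst (suc s ≤_) (sym (+-suc s (r / p))) (s≤s (m≤m+n s (r / p)))
      trade : p * p * n * t ≤ (s + t) * D
      trade = begin
        p * p * n * t                 ≡⟨ e₁ p n t ⟩
        (p * n) * (t * p)             ≤⟨ *-mono-≤ (<⇒≤ (m<[1+m/n]*n (p * n) (2 * r))) tp≤2r ⟩
        suc s * (2 * r) * (2 * r)     ≡⟨ e₂ s r ⟩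
        suc s * (4 * (r * r))         ≤⟨ *-mono-≤ s+1≤s+t (*-monoˡ-≤ (r * r) 4≤8) ⟩
        (s + t) * (8 * (r * r))       ≡⟨ cong ((s + t) *_) (*-assoc 8 r r) ⟨
        (s + t) * D                   ∎
        where
        4≤8 : 4 ≤ 8
        4≤8 = s≤s (s≤s (s≤s (s≤s z≤n)))
        e₁ : ∀ p n t → p * p * n * t ≡ (p * n) * (t * p)
        e₁ = solve-∀
        e₂ : ∀ s r → suc s * (2 * r) * (2 * r) ≡ suc s * (4 * (r * r))
        e₂ = solve-∀
      exponents : n * t * D + p * p * n * t ≤ D * n * t + (s + t) * D
      exponents = +-mono-≤ (≤-reflexive (e n t D)) trade
        where
        e : ∀ n t D → n * t * D ≡ D * n * t
        e = solve-∀
      ppn≤Dn : p * p * n ≤ D * n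
      ppn≤Dn = *-monoˡ-≤ n (begin
        p * p         ≤⟨ *-mono-≤ p≤r p≤r ⟩
        r * r         ≤⟨ m≤n*m (r * r) 8 ⟩
        8 * (r * r)   ≡⟨ *-assoc 8 r r ⟨
        8 * r * r     ∎)


open import Algebra.Bundles using (Group)

module NewtonSeries {g ℓ} (G : Group g ℓ) where

  open import Data.List using (List; []; _∷_; length; drop)
  open import Data.Nat using (ℕ; zero; suc; _+_; _≤_; s≤s)
  open import Data.Nat.Properties using (m≤n⇒m≤1+n)
  open import Function using (_∘_)
  open import Relation.Binary.PropositionalEquality as ≡ using (_≡_)

  open Group G
  open import Algebra.Properties.Group G using (\\-leftDividesˡ; //-rightDividesˡ)
  open import Relation.Binary.Reasoning.Setoid setoid

  -- newton bs k = Σⱼ bsⱼ · C(k, j), computed by Pascal's rule.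
  newton : List Carrier → ℕ → Carrier
  newton []       _       = ε
  newton (b ∷ bs) zero    = b
  newton (b ∷ bs) (suc k) = newton (b ∷ bs) k ∙ newton bs k

  newton-suc : ∀ bs k → newton bs (suc k) ≈ newton bs k ∙ newton (drop 1 bs) k
  newton-suc []       k = sym (identityˡ ε)
  newton-suc (b ∷ bs) k = refl

  Δ : (ℕ → Carrier) → ℕ → Carrier
  Δ f k = f k \\ f (suc k)

  interpolate : ℕ → (ℕ → Carrier) → List Carrier
  interpolate zero    f = f 0 ∷ []
  interpolate (suc W) f = f 0 ∷ interpolate W (Δ f)

  length-interpolate : ∀ W f → length (interpolate W f) ≡ suc W
  length-interpolate zero    f = ≡.refl
  length-interpolate (suc W) f = ≡.cong suc (length-interpolate W (Δ f))

  newton-interpolate : ∀ W f k → k ≤ W → newton (interpolate W f) k ≈ f k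
  newton-interpolate zero    f zero    _         = refl
  newton-interpolate (suc W) f zero    _         = refl
  newton-interpolate (suc W) f (suc k) (s≤s k≤W) = begin
    newton (interpolate (suc W) f) k ∙ newton (interpolate W (Δ f)) k
      ≈⟨ ∙-cong (newton-interpolate (suc W) f k (m≤n⇒m≤1+n k≤W)) (newton-interpolate W (Δ f) k k≤W) ⟩
    f k ∙ (f k \\ f (suc k))
      ≈⟨ \\-leftDividesˡ (f k) (f (suc k)) ⟩
    f (suc k) ∎

  translate : List Carrier → List Carrier
  translate []       = []
  translate (b ∷ bs) = (b // newton (translate bs) 0) ∷ translate bs

  length-translate : ∀ bs → length (translate bs) ≡ length bs
  length-translate []       = ≡.refl
  length-translate (b ∷ bs) = ≡.cong suc (length-translate bs)

  newton-translate : ∀ bs k → newton (translate bs) (suc k) ≈ newton bs k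
  newton-translate []       k       = refl
  newton-translate (b ∷ bs) zero    = //-rightDividesˡ (newton (translate bs) 0) b
  newton-translate (b ∷ bs) (suc k) = ∙-cong (newton-translate (b ∷ bs) k) (newton-translate bs k)

  interpolateFrom : ℕ → ℕ → (ℕ → Carrier) → List Carrier
  interpolateFrom zero    W f = interpolate W f
  interpolateFrom (suc L) W f = translate (interpolateFrom L W (f ∘ suc))

  length-interpolateFrom : ∀ L W f → length (interpolateFrom L W f) ≡ suc W
  length-interpolateFrom zero    W f = length-interpolate W f
  length-interpolateFrom (suc L) W f =
    ≡.trans (length-translate (interpolateFrom L W (f ∘ suc))) (length-interpolateFrom L W (f ∘ suc))

  newton-interpolateFrom : ∀ L W f k → L ≤ k → k ≤ L + W →
                           newton (interpolateFrom L W f) k ≈ f k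
  newton-interpolateFrom zero    W f k       _         k≤W       = newton-interpolate W f k k≤W
  newton-interpolateFrom (suc L) W f (suc k) (s≤s L≤k) (s≤s k≤) =
    trans (newton-translate (interpolateFrom L W (f ∘ suc)) k)
          (newton-interpolateFrom L W (f ∘ suc) k L≤k k≤)

module NewtonPolynomial where

  open BinomialSums using (binomialSum; binomialSum-suc; sum-applyUpTo-const-0)
  open import Data.Bool using (Bool; true; false)
  open import Data.List using (List; []; _∷_; length; drop; map; _++_)
  open import Data.List.Properties using (length-++; length-map; length-drop)
  open import Data.Nat as ℕ using (ℕ; zero; suc)
  open import Data.Product using (_×_; _,_)
  open import Data.Fin.Subset using (Subset)
  open import Data.Vec using (Vec; []; _∷_) renaming (map to vmap)
  open import Relation.Binary.PropositionalEquality as ≡ using (_≡_)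

  module _ {c ℓ} (K : Field c ℓ) where

    open Field K
    open NewtonSeries +-group using (newton; newton-suc)
    open import Algebra.Properties.CommutativeSemigroup *-commutativeSemigroup
      using (x∙yz≈y∙xz; interchange)

    liftTerm : ∀ {n} → Bool → Carrier × Subset n × Subset n → Carrier × Subset (suc n) × Subset (suc n)
    liftTerm b (a , S , T) = a , b ∷ S , b ∷ T

    -- newtonPoly n bs = Σ_{S ⊆ [n]} bs_{|S|} · ∏_{i∈S} xᵢ yᵢ
    newtonPoly : (n : ℕ) → List Carrier → MPoly K n
    newtonPoly zero    []      = []
    newtonPoly zero    (b ∷ _) = (b , [] , []) ∷ []
    newtonPoly (suc n) bs      =
      map (liftTerm false) (newtonPoly n bs) ++ map (liftTerm true) (newtonPoly n (drop 1 bs))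

    length-newtonPoly : ∀ n bs → length (newtonPoly n bs) ≡ binomialSum n (length bs)
    length-newtonPoly zero    []       = ≡.refl
    length-newtonPoly zero    (b ∷ bs) = ≡.sym (≡.cong suc (sum-applyUpTo-const-0 (length bs)))
    length-newtonPoly (suc n) bs       = begin
      length (map (liftTerm false) P ++ map (liftTerm true) Q)
        ≡⟨ length-++ (map (liftTerm false) P) ⟩
      length (map (liftTerm false) P) ℕ.+ length (map (liftTerm true) Q)
        ≡⟨ ≡.cong₂ ℕ._+_ (length-map (liftTerm false) P) (length-map (liftTerm true) Q) ⟩
      length P ℕ.+ length Q
        ≡⟨ ≡.cong₂ ℕ._+_ (length-newtonPoly n bs) (length-newtonPoly n (drop 1 bs)) ⟩
      binomialSum n (length bs) ℕ.+ binomialSum n (length (drop 1 bs))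
        ≡⟨ ≡.cong (λ l → binomialSum n (length bs) ℕ.+ binomialSum n l) (length-drop 1 bs) ⟩
      binomialSum n (length bs) ℕ.+ binomialSum n (length bs ℕ.∸ 1)
        ≡⟨ binomialSum-suc n (length bs) ⟨
      binomialSum (suc n) (length bs) ∎
      where
      open ≡.≡-Reasoning
      P = newtonPoly n bs
      Q = newtonPoly n (drop 1 bs)

    eval-++ : ∀ {n} (P Q : MPoly K n) X Y → eval K (P ++ Q) X Y ≈ eval K P X Y + eval K Q X Y
    eval-++ []                Q X Y = sym (+-identityˡ _)
    eval-++ ((a , S , T) ∷ P) Q X Y = begin
      t + eval K (P ++ Q) X Y              ≈⟨ +-congˡ (eval-++ P Q X Y) ⟩
      t + (eval K P X Y + eval K Q X Y)    ≈⟨ +-assoc t _ _ ⟨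
      t + eval K P X Y + eval K Q X Y      ∎
      where
      open import Relation.Binary.Reasoning.Setoid setoid
      t = a * monoVal K S X * monoVal K T Y

    eval-liftTerm-false : ∀ {n} (P : MPoly K n) u v X Y →
                          eval K (map (liftTerm false) P) (u ∷ X) (v ∷ Y) ≈ eval K P X Y
    eval-liftTerm-false []                u v X Y = refl
    eval-liftTerm-false ((a , S , T) ∷ P) u v X Y = +-congˡ (eval-liftTerm-false P u v X Y)

    eval-liftTerm-true : ∀ {n} (P : MPoly K n) u v X Y →
                         eval K (map (liftTerm true) P) (u ∷ X) (v ∷ Y) ≈ (u * v) * eval K P X Y
    eval-liftTerm-true []                u v X Y = sym (zeroʳ (u * v))
    eval-liftTerm-true ((a , S , T) ∷ P) u v X Y = begin
      a * (u * s) * (v * t) + eval K (map (liftTerm true) P) (u ∷ X) (v ∷ Y)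
        ≈⟨ +-cong (*-congʳ (x∙yz≈y∙xz a u s)) (eval-liftTerm-true P u v X Y) ⟩
      u * (a * s) * (v * t) + (u * v) * eval K P X Y
        ≈⟨ +-congʳ (interchange u (a * s) v t) ⟩
      (u * v) * (a * s * t) + (u * v) * eval K P X Y
        ≈⟨ distribˡ (u * v) _ _ ⟨
      (u * v) * (a * s * t + eval K P X Y) ∎
      where
      open import Relation.Binary.Reasoning.Setoid setoid
      s = monoVal K S X
      t = monoVal K T Y

    eval-newtonPoly : ∀ n bs (x y : Vec Bool n) →
                      eval K (newtonPoly n bs) (vmap (bit K) x) (vmap (bit K) y) ≈ newton bs ⟨ x , y ⟩
    eval-newtonPoly zero    []       []      []      = refl
    eval-newtonPoly zero    (b ∷ bs) []      []      = begin
      b * 1# * 1# + 0#   ≈⟨ +-identityʳ _ ⟩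
      b * 1# * 1#        ≈⟨ *-identityʳ _ ⟩
      b * 1#             ≈⟨ *-identityʳ b ⟩
      b                  ∎
      where open import Relation.Binary.Reasoning.Setoid setoid
    eval-newtonPoly (suc n) bs       (a ∷ x) (c ∷ y) = begin
      eval K (map (liftTerm false) P ++ map (liftTerm true) Q) (bit K a ∷ X) (bit K c ∷ Y)
        ≈⟨ eval-++ (map (liftTerm false) P) _ _ _ ⟩
      eval K (map (liftTerm false) P) (bit K a ∷ X) (bit K c ∷ Y) +
      eval K (map (liftTerm true) Q) (bit K a ∷ X) (bit K c ∷ Y)
        ≈⟨ +-cong (eval-liftTerm-false P _ _ X Y) (eval-liftTerm-true Q _ _ X Y) ⟩
      eval K P X Y + (bit K a * bit K c) * eval K Q X Y
        ≈⟨ +-cong (eval-newtonPoly n bs x y) (*-congˡ (eval-newtonPoly n (drop 1 bs) x y)) ⟩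
      newton bs k + (bit K a * bit K c) * newton (drop 1 bs) k
        ≈⟨ step a c ⟩
      newton bs ⟨ a ∷ x , c ∷ y ⟩ ∎
      where
      open import Relation.Binary.Reasoning.Setoid setoid
      P = newtonPoly n bs
      Q = newtonPoly n (drop 1 bs)
      X = vmap (bit K) x
      Y = vmap (bit K) y
      k = ⟨ x , y ⟩
      absent : ∀ {z} w → z ≈ 0# → newton bs k + z * w ≈ newton bs k
      absent w z≈0 = trans (+-congˡ (trans (*-congʳ z≈0) (zeroˡ w))) (+-identityʳ _)
      step : ∀ a c → newton bs k + (bit K a * bit K c) * newton (drop 1 bs) k ≈ newton bs ⟨ a ∷ x , c ∷ y ⟩
      step false c     = absent _ (zeroˡ (bit K c))
      step true  false = absent _ (zeroʳ 1#)
      step true  true  = trans (+-congˡ (trans (*-congʳ (*-identityˡ 1#)) (*-identityˡ _)))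
                               (sym (newton-suc bs k))

open import Data.Nat using (ℕ)

module SignPolynomial {a ℓ} (K : Field a ℓ) (p r′ n : ℕ) where

  open import Data.Bool using (Bool)
  open import Data.List using (List; length)
  open import Data.Nat
  open import Data.Product using (_,_)
  open import Data.Vec using (Vec; map)
  open import Relation.Binary.PropositionalEquality using (_≡_; cong; trans; subst; sym)
  open BinomialSums using (binomialSum)
  open BandCounting.Band p r′ n public using (r)
  open BandCounting.Band p r′ n hiding (r)
  open NewtonSeries (Field.+-group K) using (interpolateFrom; length-interpolateFrom; newton-interpolateFrom)
  open NewtonPolynomial

  coefficients : List (Field.Carrier K)
  coefficients = interpolateFrom lower width (signPow K)

  signPoly : MPoly K n
  signPoly = newtonPoly K n coefficients

  length-signPoly : length signPoly ≡ binomialSum n (suc width)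
  length-signPoly = trans (length-newtonPoly K n coefficients)
                          (cong (binomialSum n) (length-interpolateFrom lower width (signPow K)))

  signPoly-count : .{{_ : NonZero p}} → 1 ≤ n → 2 * p ≤ r →
                   length signPoly ^ (8 * r * r) ≤ 2 ^ (8 * r * r * n ∸ p * p * n)
  signPoly-count n≥1 2p≤r =
    subst (λ m → m ^ (8 * r * r) ≤ 2 ^ (8 * r * r * n ∸ p * p * n)) (sym length-signPoly)
          (count-bound n≥1 2p≤r)

  signPoly-agrees : ∀ (x y : Vec Bool n) →
                    2 * p * n ≤ ⟨ x , y ⟩ * r → ⟨ x , y ⟩ * (2 * r) ≤ (r + 2 * p) * n →
                    Field._≈_ K (eval K signPoly (map (bit K) x) (map (bit K) y)) (signPow K ⟨ x , y ⟩)
  signPoly-agrees x y lo hi with band⊆window lo hi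
  ... | lower≤k , k≤upper = Field.trans K (eval-newtonPoly K n coefficients x y)
    (newton-interpolateFrom lower width (signPow K) ⟨ x , y ⟩ lower≤k k≤upper)

open import Data.Bool using (Bool)
open import Data.Nat using (ℕ; _≥_)
open import Data.Integer using (+_)
open import Data.Rational using (ℚ; _<_; _≤_; _+_; _-_; _*_; _/_; 0ℚ; ½)
open import Data.Vec using (Vec; map)
open import Data.List using (length)
open import Data.Product using (Σ; _×_)

import Data.Nat as ℕ
import Data.Nat.Properties as ℕ
open import Data.Integer as ℤ using (-[1+_])
import Data.Integer.Properties as ℤ
open import Data.Product using (_,_)
open import Data.Rational using (mkℚ; *<*; ↥_; ↧_; ↧ₙ_; toℚᵘ; NonNegative)
open import Data.Rational.Properties
open import Data.Rational.Solver using (module +-*-Solver)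
open import Data.Rational.Unnormalised as ℚᵘ using (mkℚᵘ; *≡*; *≤*)
import Data.Rational.Unnormalised.Properties as ℚᵘ
open import Relation.Binary.PropositionalEquality

fromℕ : ℕ → ℚ
fromℕ n = + n / 1

toℚᵘ-fromℕ : ∀ n → toℚᵘ (fromℕ n) ℚᵘ.≃ mkℚᵘ (+ n) 0
toℚᵘ-fromℕ n = toℚᵘ-fromℚᵘ (mkℚᵘ (+ n) 0)

fromℕ-+ : ∀ m n → fromℕ (m ℕ.+ n) ≡ fromℕ m + fromℕ n
fromℕ-+ m n = toℚᵘ-injective (begin
  toℚᵘ (fromℕ (m ℕ.+ n))                 ≈⟨ toℚᵘ-fromℕ (m ℕ.+ n) ⟩
  mkℚᵘ (+ (m ℕ.+ n)) 0                   ≈⟨ *≡* (cong (ℤ._* + 1) eq) ⟩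
  mkℚᵘ (+ m) 0 ℚᵘ.+ mkℚᵘ (+ n) 0         ≈⟨ ℚᵘ.+-cong (toℚᵘ-fromℕ m) (toℚᵘ-fromℕ n) ⟨
  toℚᵘ (fromℕ m) ℚᵘ.+ toℚᵘ (fromℕ n)     ≈⟨ toℚᵘ-homo-+ (fromℕ m) (fromℕ n) ⟨
  toℚᵘ (fromℕ m + fromℕ n)               ∎)
  where
  open import Relation.Binary.Reasoning.Setoid ℚᵘ.≃-setoid
  eq : + (m ℕ.+ n) ≡ + m ℤ.* + 1 ℤ.+ + n ℤ.* + 1
  eq = trans (ℤ.pos-+ m n) (sym (cong₂ ℤ._+_ (ℤ.*-identityʳ (+ m)) (ℤ.*-identityʳ (+ n))))

fromℕ-* : ∀ m n → fromℕ (m ℕ.* n) ≡ fromℕ m * fromℕ n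
fromℕ-* m n = toℚᵘ-injective (begin
  toℚᵘ (fromℕ (m ℕ.* n))                 ≈⟨ toℚᵘ-fromℕ (m ℕ.* n) ⟩
  mkℚᵘ (+ (m ℕ.* n)) 0                   ≈⟨ *≡* (cong (ℤ._* + 1) (ℤ.pos-* m n)) ⟩
  mkℚᵘ (+ m) 0 ℚᵘ.* mkℚᵘ (+ n) 0         ≈⟨ ℚᵘ.*-cong (toℚᵘ-fromℕ m) (toℚᵘ-fromℕ n) ⟨
  toℚᵘ (fromℕ m) ℚᵘ.* toℚᵘ (fromℕ n)     ≈⟨ toℚᵘ-homo-* (fromℕ m) (fromℕ n) ⟨
  toℚᵘ (fromℕ m * fromℕ n)               ∎)
  where open import Relation.Binary.Reasoning.Setoid ℚᵘ.≃-setoid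

fromℕ-*³ : ∀ a b c → fromℕ (a ℕ.* b ℕ.* c) ≡ fromℕ a * fromℕ b * fromℕ c
fromℕ-*³ a b c = trans (fromℕ-* (a ℕ.* b) c) (cong (_* fromℕ c) (fromℕ-* a b))

fromℕ-nonNeg : ∀ n → NonNegative (fromℕ n)
fromℕ-nonNeg n = normalize-nonNeg n 1

fromℕ-∸ : ∀ {m n} → n ℕ.≤ m → fromℕ (m ℕ.∸ n) ≡ fromℕ m - fromℕ n
fromℕ-∸ {m} {n} n≤m = begin
  fromℕ (m ℕ.∸ n)                        ≡⟨ solve 2 (λ x y → x := x :+ y :- y) refl (fromℕ (m ℕ.∸ n)) (fromℕ n) ⟩
  fromℕ (m ℕ.∸ n) + fromℕ n - fromℕ n    ≡⟨ cong (_- fromℕ n) (fromℕ-+ (m ℕ.∸ n) n) ⟨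
  fromℕ (m ℕ.∸ n ℕ.+ n) - fromℕ n        ≡⟨ cong (λ k → fromℕ k - fromℕ n) (ℕ.m∸n+n≡m n≤m) ⟩
  fromℕ m - fromℕ n                      ∎
  where
  open ≡-Reasoning
  open +-*-Solver

fromℕ-cancel-≤ : ∀ {m n} → fromℕ m ≤ fromℕ n → m ℕ.≤ n
fromℕ-cancel-≤ {m} {n} m≤n
  with ℚᵘ.≤-respʳ-≃ (toℚᵘ-fromℕ n) (ℚᵘ.≤-respˡ-≃ (toℚᵘ-fromℕ m) (toℚᵘ-mono-≤ m≤n))
... | *≤* h = ℤ.drop‿+≤+ (subst₂ ℤ._≤_ (ℤ.*-identityʳ (+ m)) (ℤ.*-identityʳ (+ n)) h)

*-denominator : ∀ q {a} → ↥ q ≡ + a → q * fromℕ (↧ₙ q) ≡ fromℕ a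
*-denominator q@(mkℚ (+ a) d _) refl = toℚᵘ-injective (begin
  toℚᵘ (q * fromℕ (ℕ.suc d))                ≈⟨ toℚᵘ-homo-* q (fromℕ (ℕ.suc d)) ⟩
  mkℚᵘ (+ a) d ℚᵘ.* toℚᵘ (fromℕ (ℕ.suc d))  ≈⟨ ℚᵘ.*-congˡ {mkℚᵘ (+ a) d} (toℚᵘ-fromℕ (ℕ.suc d)) ⟩
  mkℚᵘ (+ a) d ℚᵘ.* mkℚᵘ (+ ℕ.suc d) 0      ≈⟨ *≡* eq ⟩
  mkℚᵘ (+ a) 0                              ≈⟨ toℚᵘ-fromℕ a ⟨
  toℚᵘ (fromℕ a)                            ∎)
  where
  open import Relation.Binary.Reasoning.Setoid ℚᵘ.≃-setoid
  eq : (+ a ℤ.* + ℕ.suc d) ℤ.* + 1 ≡ + a ℤ.* + (ℕ.suc d ℕ.* 1)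
  eq = trans (ℤ.*-identityʳ _) (cong (λ k → + a ℤ.* + k) (sym (ℕ.*-identityʳ (ℕ.suc d))))

*-fromℕ⇒cross : ∀ q d {a} → q * fromℕ d ≡ fromℕ a → ↥ q ℤ.* + d ≡ + a ℤ.* ↧ q
*-fromℕ⇒cross q@(mkℚ n e _) d {a} eq with begin
  toℚᵘ q ℚᵘ.* mkℚᵘ (+ d) 0            ≈⟨ ℚᵘ.*-congˡ {toℚᵘ q} (toℚᵘ-fromℕ d) ⟨
  toℚᵘ q ℚᵘ.* toℚᵘ (fromℕ d)          ≈⟨ toℚᵘ-homo-* q (fromℕ d) ⟨
  toℚᵘ (q * fromℕ d)                  ≈⟨ toℚᵘ-cong eq ⟩
  toℚᵘ (fromℕ a)                      ≈⟨ toℚᵘ-fromℕ a ⟩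
  mkℚᵘ (+ a) 0                        ∎
  where open import Relation.Binary.Reasoning.Setoid ℚᵘ.≃-setoid
... | *≡* h = trans (sym (ℤ.*-identityʳ _)) (trans h (cong (λ k → + a ℤ.* + k) (ℕ.*-identityʳ (ℕ.suc e))))

≤2^-intro : ∀ M q d a .{{_ : ℕ.NonZero d}} → q * fromℕ d ≡ fromℕ a → M ℕ.^ d ℕ.≤ 2 ℕ.^ a → M ≤2^ q
≤2^-intro M q@(mkℚ (+ m) e _) d@(ℕ.suc _) a eq bound =
  subst (ℕ._≤ 2 ℕ.^ m) (ℕ.*-identityʳ (M ℕ.^ ℕ.suc e))
    (Powers.2^-bound-rescale {M} {d} {0} {a} {ℕ.suc e} {0} {m}
      (subst (ℕ._≤ 2 ℕ.^ a) (sym (ℕ.*-identityʳ (M ℕ.^ d))) bound) exponents)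
  where
  exponents : a ℕ.* ℕ.suc e ℕ.+ 0 ℕ.≤ m ℕ.* d ℕ.+ 0
  exponents = ℕ.+-monoˡ-≤ 0 (ℕ.≤-reflexive (ℤ.+-injective (begin
    + (a ℕ.* ℕ.suc e)  ≡⟨ ℤ.pos-* a (ℕ.suc e) ⟩
    + a ℤ.* + ℕ.suc e  ≡⟨ *-fromℕ⇒cross q d {a} eq ⟨
    + m ℤ.* + d        ≡⟨ ℤ.pos-* m d ⟨
    + (m ℕ.* d)        ∎)))
    where open ≡-Reasoning
≤2^-intro M q@(mkℚ -[1+ m ] e _) d@(ℕ.suc _) a eq bound
  with () ← trans (*-fromℕ⇒cross q d {a} eq) (sym (ℤ.pos-* a (ℕ.suc e)))

module Ratio (ε : ℚ) (p r : ℕ) (εr≡p : ε * fromℕ r ≡ fromℕ p) where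

  open +-*-Solver

  band-lower : ∀ n k → fromℕ 2 * ε * fromℕ n ≤ fromℕ k → 2 ℕ.* p ℕ.* n ℕ.≤ k ℕ.* r
  band-lower n k h = fromℕ-cancel-≤ (begin
    fromℕ (2 ℕ.* p ℕ.* n)              ≡⟨ fromℕ-*³ 2 p n ⟩
    fromℕ 2 * fromℕ p * fromℕ n        ≡⟨ cong (λ x → fromℕ 2 * x * fromℕ n) εr≡p ⟨
    fromℕ 2 * (ε * fromℕ r) * fromℕ n  ≡⟨ regroup ε (fromℕ n) (fromℕ r) ⟩
    fromℕ 2 * ε * fromℕ n * fromℕ r    ≤⟨ *-monoʳ-≤-nonNeg (fromℕ r) {{fromℕ-nonNeg r}} h ⟩
    fromℕ k * fromℕ r                  ≡⟨ fromℕ-* k r ⟨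
    fromℕ (k ℕ.* r)                    ∎)
    where
    open ≤-Reasoning
    regroup : ∀ e n r → fromℕ 2 * (e * r) * n ≡ fromℕ 2 * e * n * r
    regroup = solve 3 (λ e n r → con (fromℕ 2) :* (e :* r) :* n := con (fromℕ 2) :* e :* n :* r) refl

  band-upper : ∀ n k → fromℕ k ≤ (½ + ε) * fromℕ n → k ℕ.* (2 ℕ.* r) ℕ.≤ (r ℕ.+ 2 ℕ.* p) ℕ.* n
  band-upper n k h = fromℕ-cancel-≤ (begin
    fromℕ (k ℕ.* (2 ℕ.* r))                        ≡⟨ fromℕ-* k (2 ℕ.* r) ⟩
    fromℕ k * fromℕ (2 ℕ.* r)                      ≤⟨ *-monoʳ-≤-nonNeg (fromℕ (2 ℕ.* r)) {{fromℕ-nonNeg (2 ℕ.* r)}} h ⟩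
    (½ + ε) * fromℕ n * fromℕ (2 ℕ.* r)            ≡⟨ cong ((½ + ε) * fromℕ n *_) (fromℕ-* 2 r) ⟩
    (½ + ε) * fromℕ n * (fromℕ 2 * fromℕ r)        ≡⟨ regroup ε (fromℕ n) (fromℕ r) ⟩
    (fromℕ r + fromℕ 2 * (ε * fromℕ r)) * fromℕ n  ≡⟨ cong (λ x → (fromℕ r + fromℕ 2 * x) * fromℕ n) εr≡p ⟩
    (fromℕ r + fromℕ 2 * fromℕ p) * fromℕ n        ≡⟨ cong (λ x → (fromℕ r + x) * fromℕ n) (fromℕ-* 2 p) ⟨
    (fromℕ r + fromℕ (2 ℕ.* p)) * fromℕ n          ≡⟨ cong (_* fromℕ n) (fromℕ-+ r (2 ℕ.* p)) ⟨
    fromℕ (r ℕ.+ 2 ℕ.* p) * fromℕ n                ≡⟨ fromℕ-* (r ℕ.+ 2 ℕ.* p) n ⟨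
    fromℕ ((r ℕ.+ 2 ℕ.* p) ℕ.* n)                  ∎)
    where
    open ≤-Reasoning
    regroup : ∀ e n r → (½ + e) * n * (fromℕ 2 * r) ≡ (r + fromℕ 2 * (e * r)) * n
    regroup = solve 3 (λ e n r → (con ½ :+ e) :* n :* (con (fromℕ 2) :* r)
                              := (r :+ con (fromℕ 2) :* (e :* r)) :* n) refl

  exponent-fraction : ∀ n → p ℕ.≤ r →
    (fromℕ n - + 1 / 8 * ε * ε * fromℕ n) * fromℕ (8 ℕ.* r ℕ.* r) ≡
    fromℕ (8 ℕ.* r ℕ.* r ℕ.* n ℕ.∸ p ℕ.* p ℕ.* n)
  exponent-fraction n p≤r = begin
    q * fromℕ (8 ℕ.* r ℕ.* r)                          ≡⟨ cong (q *_) (fromℕ-*³ 8 r r) ⟩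
    q * (fromℕ 8 * fromℕ r * fromℕ r)                  ≡⟨ clear ε (fromℕ n) (fromℕ r) ⟩
    R * fromℕ n - (ε * fromℕ r) * (ε * fromℕ r) * fromℕ n
      ≡⟨ cong (λ x → R * fromℕ n - x * x * fromℕ n) εr≡p ⟩
    R * fromℕ n - fromℕ p * fromℕ p * fromℕ n
      ≡⟨ cong₂ _-_ (trans (fromℕ-* (8 ℕ.* r ℕ.* r) n) (cong (_* fromℕ n) (fromℕ-*³ 8 r r))) (fromℕ-*³ p p n) ⟨
    fromℕ (8 ℕ.* r ℕ.* r ℕ.* n) - fromℕ (p ℕ.* p ℕ.* n)  ≡⟨ fromℕ-∸ p²n≤8r²n ⟨
    fromℕ (8 ℕ.* r ℕ.* r ℕ.* n ℕ.∸ p ℕ.* p ℕ.* n)       ∎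
    where
    open ≡-Reasoning
    q = fromℕ n - + 1 / 8 * ε * ε * fromℕ n
    R = fromℕ 8 * fromℕ r * fromℕ r
    clear : ∀ e n r → (n - + 1 / 8 * e * e * n) * (fromℕ 8 * r * r) ≡
                      fromℕ 8 * r * r * n - (e * r) * (e * r) * n
    clear = solve 3 (λ e n r → (n :- con (+ 1 / 8) :* e :* e :* n) :* (con (fromℕ 8) :* r :* r)
                            := con (fromℕ 8) :* r :* r :* n :- (e :* r) :* (e :* r) :* n) refl
    p²n≤8r²n : p ℕ.* p ℕ.* n ℕ.≤ 8 ℕ.* r ℕ.* r ℕ.* n
    p²n≤8r²n = ℕ.*-monoˡ-≤ n (ℕ.≤-trans (ℕ.*-mono-≤ p≤r p≤r) (ℕ.*-monoˡ-≤ r (ℕ.m≤n*m r 8)))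

<½⇒2*↥<↧ : ∀ q {p} → ↥ q ≡ + p → q < ½ → 2 ℕ.* p ℕ.< ↧ₙ q
<½⇒2*↥<↧ (mkℚ (+ p) r′ _) refl q<½ = subst₂ ℕ._<_ (ℕ.*-comm p 2) (ℕ.*-identityˡ (ℕ.suc r′))
  (ℤ.drop‿+<+ (subst₂ ℤ._<_ (sym (ℤ.pos-* p 2)) (sym (ℤ.pos-* 1 (ℕ.suc r′))) (drop-*<* q<½)))

lemma3p1 : Σω ℚ (λ c → 0ℚ < c) λ c → (∀ {a ℓ} (K : Field a ℓ) (ε : ℚ) (n : ℕ) → 0ℚ < ε → ε < ½ → n ≥ 1 →
               Σ (MPoly K n) λ p →
                 (length p ≤2^ ((+ n / 1) - c * ε * ε * (+ n / 1)))
                 × (∀ (x y : Vec Bool n) →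
                      (+ 2 / 1) * ε * (+ n / 1) ≤ (+ ⟨ x , y ⟩ / 1) →
                      (+ ⟨ x , y ⟩ / 1) ≤ (½ + ε) * (+ n / 1) →
                      Field._≈_ K (eval K p (map (bit K) x) (map (bit K) y)) (signPow K ⟨ x , y ⟩)))
lemma3p1 = (+ 1 / 8) ,ω *<* (ℤ.+<+ (ℕ.s≤s ℕ.z≤n)) ,ω λ where
  K (mkℚ (+ 0) _ _) _ (*<* (ℤ.+<+ ())) _ _
  K (mkℚ -[1+ _ ] _ _) _ (*<* ()) _ _
  K ε@(mkℚ (+ p@(ℕ.suc _)) r′ _) n _ ε<½ n≥1 →
    let open SignPolynomial K p r′ n
        open Ratio ε p r (*-denominator ε refl)
        2p≤r = ℕ.<⇒≤ (<½⇒2*↥<↧ ε refl ε<½)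
    in signPoly
     , ≤2^-intro (length signPoly) _ (8 ℕ.* r ℕ.* r) (8 ℕ.* r ℕ.* r ℕ.* n ℕ.∸ p ℕ.* p ℕ.* n)
                 (exponent-fraction n (ℕ.≤-trans (ℕ.m≤m+n p (p ℕ.+ 0)) 2p≤r)) (signPoly-count n≥1 2p≤r)
     , λ x y lo hi → signPoly-agrees x y (band-lower n ⟨ x , y ⟩ lo) (band-upper n ⟨ x , y ⟩ hi)
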